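{- Let $A$ be a positive integer such that $\left(\frac{A}{F_n}\right)=-1$ for infinitely many positive integers $n$. Then the pair $A,2$ is order-dominant, i.e., there are infinitely many primes $p$ with $\mathrm{ord}_p(A)>\mathrm{ord}_p(2)$.
   Context: $F_n=2^{2^n}+1$ denotes the $n$th Fermat number, and $\left(\frac{\cdot}{\cdot}\right)$ is the Jacobi symbol. For a prime $p$ not dividing an integer $a$, $\mathrm{ord}_p(a)$ is the multiplicative order of $a\bmod p$ in $\mathbb{F}_p^{\times}$. -}

module Defs where

open import Data.Nat using (ℕ; zero; suc; _+_; _*_; _^_; _≤_; _<_)
open import Data.Nat.Divisibility using (_∣_)
open import Data.Nat.Primality using (Prime)
open import Data.Nat.DivMod using (_%_)
open import Data.Integer as ℤ using (ℤ; +_; -[1+_])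
open import Data.Product using (∃; _×_)
open import Relation.Nullary using (¬_)

F : ℕ → ℕ
F n = 2 ^ (2 ^ n) + 1

QR : ℕ → (p : ℕ) → .{{_ : Data.Nat.NonZero p}} → Set
QR a p = ∃ λ x → (x * x) % p ≡ a % p
  where open import Relation.Binary.PropositionalEquality using (_≡_)

data Legendre (a p : ℕ) : ℤ → Set where
  leg-zero  : p ∣ a → Legendre a p (+ 0)
  leg-plus  : .{{_ : Data.Nat.NonZero p}} → ¬ (p ∣ a) → QR a p → Legendre a p (+ 1)
  leg-minus : .{{_ : Data.Nat.NonZero p}} → ¬ (p ∣ a) → ¬ QR a p → Legendre a p (-[1+ 0 ])

-- Well defined, since the factorisation
-- is unique up to order.  Used only for odd m.
data Jacobi (a : ℕ) : ℕ → ℤ → Set where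
  jac-one  : Jacobi a 1 (+ 1)
  jac-step : ∀ {p m l s} → Prime p → Legendre a p l → Jacobi a m s →
             Jacobi a (p * m) (l ℤ.* s)

IsOrd : ℕ → ℕ → ℕ → Set
IsOrd p a k = 1 ≤ k × (p ∣ (a ^ k ∸ 1)) × (∀ j → 1 ≤ j → j < k → ¬ (p ∣ (a ^ j ∸ 1)))
  where open import Data.Nat using (_∸_)

-- Let p be a prime factor of F (n + 2) with (A/p) = -1; it exists because the Jacobi
-- symbol is multiplicative. Modulo p we have 2^(2^(n+2)) ≡ -1, so ord_p 2 = 2^(n+3) ≤ p,
-- and 2 ≡ (w³ - w)² with w = 2^(2^n), because w⁴ ≡ -1. Since 2 has order 2^(n+3), every
-- 2^e-th root of unity with e ≤ n + 3 is a power of 2, hence a square. If ord_p A = 2^e·M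
-- with M odd were at most 2^(n+3), then A^M would be such a root of unity, hence a square,
-- and so would A itself (M is odd): a contradiction.
module Submission where

open import Data.Fin using (Fin; toℕ; fromℕ<)
open import Data.Fin.Properties using (pigeonhole; toℕ-fromℕ<; toℕ<n)
open import Data.Integer using (-[1+_])
import Data.Integer.Properties as ℤ
open import Data.Nat
open import Data.Nat.Coprimality using (Coprime; coprime-divisor)
open import Data.Nat.DivMod
open import Data.Nat.Divisibility
open import Data.Nat.Induction using (<-rec)
open import Data.Nat.Primality
open import Data.Nat.Properties
open import Data.Nat.Tactic.RingSolver using (solve-∀)
open import Data.Product using (∃; ∃₂; _×_; _,_)
open import Data.Sum using (_⊎_; inj₁; inj₂; [_,_]′)
open import Function using (_∘_)
open import Relation.Binary.PropositionalEquality
open import Relation.Nullary using (¬_; yes; no; contradiction)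
open import Relation.Unary using (Decidable)

open import Defs

jacobi≡-1⇒legendre≡-1 : ∀ {a m s} → Jacobi a m s → s ≡ -[1+ 0 ] →
  ∃ λ p → Prime p × p ∣ m × Legendre a p -[1+ 0 ]
jacobi≡-1⇒legendre≡-1 jac-one ()
jacobi≡-1⇒legendre≡-1 (jac-step _ (leg-zero _) _) ()
jacobi≡-1⇒legendre≡-1 (jac-step {p} {s = s} _ (leg-plus _ _) J) s≡-1
  with q , q-prime , q∣m , leg ← jacobi≡-1⇒legendre≡-1 J (trans (sym (ℤ.*-identityˡ s)) s≡-1)
  = q , q-prime , ∣n⇒∣m*n p q∣m , leg
jacobi≡-1⇒legendre≡-1 (jac-step {p} {m} p-prime leg@(leg-minus _ _) _) _ =
  p , p-prime , ∣m⇒∣m*n m ∣-refl , leg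

n<2^n : ∀ n → n < 2 ^ n
n<2^n zero    = z<s
n<2^n (suc n) = begin-strict
  suc n            <⟨ s<s (n<2^n n) ⟩
  suc (2 ^ n)      ≡⟨ +-comm 1 (2 ^ n) ⟩
  2 ^ n + 1        ≤⟨ +-monoʳ-≤ (2 ^ n) (≤-trans (m^n>0 2 n) (m≤m+n (2 ^ n) 0)) ⟩
  2 ^ suc n        ∎
  where open ≤-Reasoning

[m*m]^n≡m^[2*n] : ∀ m n → (m * m) ^ n ≡ m ^ (2 * n)
[m*m]^n≡m^[2*n] m n = trans (cong (λ u → (m * u) ^ n) (sym (*-identityʳ m))) (^-*-assoc m 2 n)

∣⇒∣^ : ∀ {d z} k .{{_ : NonZero k}} → d ∣ z → d ∣ z ^ k
∣⇒∣^ {z = z} (suc k) d∣z = ∣m⇒∣m*n (z ^ k) d∣z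

¬∣⇒coprime : ∀ {p d} → Prime p → ¬ p ∣ d → Coprime d p
¬∣⇒coprime p-prime p∤d (i∣d , i∣p) with prime⇒irreducible p-prime i∣p
... | inj₁ i≡1 = i≡1
... | inj₂ refl = contradiction i∣d p∤d

∣p^k⇒≡p^i : ∀ {p d} k → Prime p → d ∣ p ^ k → ∃ λ i → i ≤ k × d ≡ p ^ i
∣p^k⇒≡p^i zero _ d∣1 = 0 , z≤n , ∣1⇒≡1 d∣1
∣p^k⇒≡p^i {p} {d} (suc k) p-prime d∣p^[1+k] with p ∣? d
... | yes (divides e refl)
  with i , i≤k , refl ← ∣p^k⇒≡p^i k p-prime
         (*-cancelˡ-∣ p {{prime⇒nonZero p-prime}} (subst (_∣ p ^ suc k) (*-comm e p) d∣p^[1+k]))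
  = suc i , s≤s i≤k , *-comm (p ^ i) p
... | no p∤d
  with i , i≤k , d≡p^i ← ∣p^k⇒≡p^i k p-prime (coprime-divisor (¬∣⇒coprime p-prime p∤d) d∣p^[1+k])
  = i , m≤n⇒m≤1+n i≤k , d≡p^i

even⊎odd : ∀ k → (∃ λ q → k ≡ q * 2) ⊎ (∃ λ r → k ≡ suc (2 * r))
even⊎odd zero = inj₁ (0 , refl)
even⊎odd (suc zero) = inj₂ (0 , refl)
even⊎odd (suc (suc k)) with even⊎odd k
... | inj₁ (q , refl) = inj₁ (suc q , refl)
... | inj₂ (r , refl) = inj₂ (suc r , cong (2 +_) (sym (+-suc r (r + 0))))

≡2^e*odd : ∀ k → 1 ≤ k → ∃₂ λ e r → k ≡ 2 ^ e * suc (2 * r)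
≡2^e*odd = <-rec _ step
  where
  step : ∀ k → (∀ {j} → j < k → 1 ≤ j → ∃₂ λ e r → j ≡ 2 ^ e * suc (2 * r)) →
         1 ≤ k → ∃₂ λ e r → k ≡ 2 ^ e * suc (2 * r)
  step k rec 1≤k with even⊎odd k
  ... | inj₂ (r , k≡) = 0 , r , trans k≡ (sym (*-identityˡ _))
  ... | inj₁ (q@(suc _) , refl)
    with e , r , q≡ ← rec (m<m*n q 2 (s<s z<s)) z<s
    = suc e , r , trans (cong (_* 2) q≡) (shift (2 ^ e) (suc (2 * r)))
    where
    shift : ∀ a b → a * b * 2 ≡ 2 * a * b
    shift = solve-∀

-- IsOrd p z is definitionally LeastPositive (λ j → p ∣ z ^ j ∸ 1).
LeastPositive : (ℕ → Set) → ℕ → Set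
LeastPositive P d = 1 ≤ d × P d × (∀ j → 1 ≤ j → j < d → ¬ P j)

module _ {P : ℕ → Set} (P? : Decidable P) where

  private
    search : ∀ m → (∃ λ d → d ≤ m × LeastPositive P d) ⊎ (∀ j → 1 ≤ j → j ≤ m → ¬ P j)
    search zero = inj₂ λ j 1≤j j≤0 → contradiction j≤0 (<⇒≱ 1≤j)
    search (suc m) with search m
    ... | inj₁ (d , d≤m , least) = inj₁ (d , m≤n⇒m≤1+n d≤m , least)
    ... | inj₂ none with P? (suc m)
    ...   | yes Pm = inj₁ (suc m , ≤-refl , z<s , Pm , λ j 1≤j j<1+m → none j 1≤j (s≤s⁻¹ j<1+m))
    ...   | no ¬Pm = inj₂ λ j 1≤j j≤1+m →
      [ (λ j<1+m → none j 1≤j (s≤s⁻¹ j<1+m)) , (λ { refl → ¬Pm }) ]′ (m≤n⇒m<n∨m≡n j≤1+m)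

  least-positive : ∀ {m} → 1 ≤ m → P m → ∃ λ d → d ≤ m × LeastPositive P d
  least-positive {m} 1≤m Pm with search m
  ... | inj₁ found = found
  ... | inj₂ none = contradiction Pm (none m 1≤m ≤-refl)

module Modulo (m : ℕ) .{{_ : NonZero m}} where

  infix 4 _≋_
  _≋_ : ℕ → ℕ → Set
  a ≋ b = a % m ≡ b % m

  ≋-+ : ∀ {a b c d} → a ≋ b → c ≋ d → a + c ≋ b + d
  ≋-+ {a} {b} {c} {d} a≋b c≋d = begin
    (a + c) % m             ≡⟨ %-distribˡ-+ a c m ⟩
    (a % m + c % m) % m     ≡⟨ cong₂ (λ x y → (x + y) % m) a≋b c≋d ⟩
    (b % m + d % m) % m     ≡⟨ %-distribˡ-+ b d m ⟨
    (b + d) % m             ∎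
    where open ≡-Reasoning

  ≋-* : ∀ {a b c d} → a ≋ b → c ≋ d → a * c ≋ b * d
  ≋-* {a} {b} {c} {d} a≋b c≋d = begin
    (a * c) % m             ≡⟨ %-distribˡ-* a c m ⟩
    (a % m * (c % m)) % m   ≡⟨ cong₂ (λ x y → (x * y) % m) a≋b c≋d ⟩
    (b % m * (d % m)) % m   ≡⟨ %-distribˡ-* b d m ⟨
    (b * d) % m             ∎
    where open ≡-Reasoning

  ≋-^ : ∀ {a b} n → a ≋ b → a ^ n ≋ b ^ n
  ≋-^ zero    _   = refl
  ≋-^ (suc n) a≋b = ≋-* a≋b (≋-^ n a≋b)

  ≋⇒∣∸ : ∀ a b → a ≋ b → m ∣ a ∸ b
  ≋⇒∣∸ a b a≋b = divides (a / m ∸ b / m) (begin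
    a ∸ b                                     ≡⟨ cong₂ _∸_ (m≡m%n+[m/n]*n a m) (m≡m%n+[m/n]*n b m) ⟩
    (a % m + a / m * m) ∸ (b % m + b / m * m) ≡⟨ cong (λ x → (a % m + a / m * m) ∸ (x + b / m * m)) a≋b ⟨
    (a % m + a / m * m) ∸ (a % m + b / m * m) ≡⟨ [m+n]∸[m+o]≡n∸o (a % m) _ _ ⟩
    a / m * m ∸ b / m * m                     ≡⟨ *-distribʳ-∸ m (a / m) (b / m) ⟨
    (a / m ∸ b / m) * m                       ∎)
    where open ≡-Reasoning

  ∣∸⇒≋ : ∀ {a b} → b ≤ a → m ∣ a ∸ b → a ≋ b
  ∣∸⇒≋ {a} {b} b≤a m∣a∸b = begin
    a % m           ≡⟨ cong (_% m) (m∸n+n≡m b≤a) ⟨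
    (a ∸ b + b) % m ≡⟨ %-remove-+ˡ b m∣a∸b ⟩
    b % m           ∎
    where open ≡-Reasoning

  ∣⇒≋0 : ∀ {a} → m ∣ a → a ≋ 0
  ∣⇒≋0 = ∣∸⇒≋ z≤n

  ≋0⇒∣ : ∀ {a} → a ≋ 0 → m ∣ a
  ≋0⇒∣ {a} = ≋⇒∣∸ a 0

  ≋-absorb : ∀ {b} a c → b ≋ 0 → a + c * b ≋ a
  ≋-absorb a c b≋0 = %-remove-+ʳ a (∣n⇒∣m*n c (≋0⇒∣ b≋0))

  -- x plays the role of -1.
  ≋-negate : ∀ {x y h} → x + 1 ≋ 0 → y + h ≋ 0 → y ≋ h * x
  ≋-negate {x} {y} {h} x+1≋0 y+h≋0 = begin
    y % m                   ≡⟨ ≋-absorb y h x+1≋0 ⟨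
    (y + h * (x + 1)) % m   ≡⟨ cong (_% m) (regroup y h x) ⟩
    ((y + h) + h * x) % m   ≡⟨ %-remove-+ˡ (h * x) (≋0⇒∣ y+h≋0) ⟩
    (h * x) % m             ∎
    where
    open ≡-Reasoning
    regroup : ∀ y h x → y + h * (x + 1) ≡ (y + h) + h * x
    regroup = solve-∀

  +1≋0⇒square≋1 : ∀ {x} → x + 1 ≋ 0 → x * x ≋ 1
  +1≋0⇒square≋1 {x} x+1≋0 = begin
    (x * x) % m               ≡⟨ ≋-absorb (x * x) 1 x+1≋0 ⟨
    (x * x + 1 * (x + 1)) % m ≡⟨ cong (_% m) (regroup x) ⟩
    (1 + x * (x + 1)) % m     ≡⟨ ≋-absorb 1 x x+1≋0 ⟩
    1 % m                     ∎
    where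
    open ≡-Reasoning
    regroup : ∀ x → x * x + 1 * (x + 1) ≡ 1 + x * (x + 1)
    regroup = solve-∀

  QR-resp-≋ : ∀ {a b} → a ≋ b → QR a m → QR b m
  QR-resp-≋ a≋b (x , x²≋a) = x , trans x²≋a a≋b

  QR-square : ∀ x → QR (x * x) m
  QR-square x = x , refl

  QR-* : ∀ {a b} → QR a m → QR b m → QR (a * b) m
  QR-* (x , x²≋a) (y , y²≋b) = x * y , trans (cong (_% m) (interchange x y)) (≋-* x²≋a y²≋b)
    where
    interchange : ∀ x y → (x * y) * (x * y) ≡ (x * x) * (y * y)
    interchange = solve-∀

  QR-^ : ∀ {a} → QR a m → ∀ n → QR (a ^ n) m
  QR-^ _    zero    = QR-square 1
  QR-^ qr-a (suc n) = QR-* qr-a (QR-^ qr-a n)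

  -- (w³ - w)² = w²(w⁴ + 1) - 2(w⁴ + 1) + 2, i.e. √2 = w³ - w when w⁴ = -1.
  w⁴+1≋0⇒QR[2] : ∀ w → w ^ 4 + 1 ≋ 0 → QR 2 m
  w⁴+1≋0⇒QR[2] w w⁴+1≋0 = s , (begin
    (s * s) % m                     ≡⟨ ≋-absorb (s * s) 2 w⁴+1≋0 ⟨
    (s * s + 2 * (w ^ 4 + 1)) % m   ≡⟨ cong (_% m) identity ⟩
    (2 + w * w * (w ^ 4 + 1)) % m   ≡⟨ ≋-absorb 2 (w * w) w⁴+1≋0 ⟩
    2 % m                           ∎)
    where
    open ≡-Reasoning
    w≤w³ : ∀ w → w ≤ w * (w * w)
    w≤w³ zero    = z≤n
    w≤w³ (suc w) = m≤m*n (suc w) _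
    s : ℕ
    s = w * (w * w) ∸ w
    s+w≡w³ : s + w ≡ w * (w * w)
    s+w≡w³ = m∸n+n≡m (w≤w³ w)
    expand : ∀ x y → x * x + 2 * (y * (x + y) + 1) ≡ (x + y) * (x + y) + y * y + 2
    expand = solve-∀
    collect : ∀ x → x * (x * x) * (x * (x * x)) + x * x + 2 ≡ 2 + x * x * (x * (x * (x * x)) + 1)
    collect = solve-∀
    w⁴≡w*w³ : w ^ 4 ≡ w * (w * (w * w))
    w⁴≡w*w³ = cong (λ u → w * (w * (w * u))) (*-identityʳ w)
    identity : s * s + 2 * (w ^ 4 + 1) ≡ 2 + w * w * (w ^ 4 + 1)
    identity = begin
      s * s + 2 * (w ^ 4 + 1)                  ≡⟨ cong (λ u → s * s + 2 * (u + 1)) w⁴≡w*w³ ⟩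
      s * s + 2 * (w * (w * (w * w)) + 1)      ≡⟨ cong (λ u → s * s + 2 * (w * u + 1)) s+w≡w³ ⟨
      s * s + 2 * (w * (s + w) + 1)            ≡⟨ expand s w ⟩
      (s + w) * (s + w) + w * w + 2            ≡⟨ cong (λ u → u * u + w * w + 2) s+w≡w³ ⟩
      w * (w * w) * (w * (w * w)) + w * w + 2  ≡⟨ collect w ⟩
      2 + w * w * (w * (w * (w * w)) + 1)      ≡⟨ cong (λ u → 2 + w * w * (u + 1)) w⁴≡w*w³ ⟨
      2 + w * w * (w ^ 4 + 1)                  ∎

  IsOrd⇒^≋1 : ∀ {z d} .{{_ : NonZero z}} → IsOrd m z d → z ^ d ≋ 1
  IsOrd⇒^≋1 {z} {d} (_ , m∣z^d∸1 , _) = ∣∸⇒≋ (m^n>0 z d) m∣z^d∸1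

  order-^ : ∀ {z d} .{{_ : NonZero z}} → IsOrd m z d → ∀ q → z ^ (d * q) ≋ 1
  order-^ {z} {d} ord q = begin
    z ^ (d * q) % m ≡⟨ cong (_% m) (^-*-assoc z d q) ⟨
    (z ^ d) ^ q % m ≡⟨ ≋-^ q (IsOrd⇒^≋1 ord) ⟩
    1 ^ q % m       ≡⟨ cong (_% m) (^-zeroˡ q) ⟩
    1 % m           ∎
    where open ≡-Reasoning

  order-∣ : ∀ {z d} .{{_ : NonZero z}} → IsOrd m z d → ∀ {t} → z ^ t ≋ 1 → d ∣ t
  order-∣ {z} {d} ord@(1≤d , _ , minimal) {t} z^t≋1 = d∣t {{>-nonZero 1≤d}}
    where
    open ≡-Reasoning
    z^[t%d]≋1 : .{{_ : NonZero d}} → z ^ (t % d) ≋ 1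
    z^[t%d]≋1 = begin
      z ^ (t % d) % m                         ≡⟨ cong (_% m) (*-identityʳ _) ⟨
      z ^ (t % d) * 1 % m                     ≡⟨ ≋-* {z ^ (t % d)} refl (order-^ ord (t / d)) ⟨
      z ^ (t % d) * z ^ (d * (t / d)) % m     ≡⟨ cong (_% m) (^-distribˡ-+-* z (t % d) _) ⟨
      z ^ (t % d + d * (t / d)) % m           ≡⟨ cong (λ u → z ^ (t % d + u) % m) (*-comm d (t / d)) ⟩
      z ^ (t % d + t / d * d) % m             ≡⟨ cong (λ u → z ^ u % m) (m≡m%n+[m/n]*n t d) ⟨
      z ^ t % m                               ≡⟨ z^t≋1 ⟩
      1 % m                                   ∎
    d∣t : .{{_ : NonZero d}} → d ∣ t
    d∣t with t % d in t%d≡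
    ... | zero  = m%n≡0⇒n∣m t d t%d≡
    ... | suc _ = contradiction (≋⇒∣∸ _ 1 z^[t%d]≋1)
                    (minimal (t % d) (subst (1 ≤_) (sym t%d≡) z<s) (m%n<n t d))

  QR-of-odd-power : ∀ {a k} r → a ^ k ≋ 1 → 1 ≤ k → QR (a ^ suc (2 * r)) m → QR a m
  QR-of-odd-power {a} {suc k} r a^k≋1 _ qr = QR-resp-≋ square*odd-power≋a (QR-* qr (QR-square (a ^ (k * r))))
    where
    open ≡-Reasoning
    exponent : ∀ k r → suc (suc k * (2 * r)) ≡ suc (2 * r) + (k * r + k * r)
    exponent = solve-∀
    square*odd-power≋a : a ^ suc (2 * r) * (a ^ (k * r) * a ^ (k * r)) ≋ a
    square*odd-power≋a = begin
      a ^ suc (2 * r) * (a ^ (k * r) * a ^ (k * r)) % m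
        ≡⟨ cong (λ u → a ^ suc (2 * r) * u % m) (^-distribˡ-+-* a (k * r) (k * r)) ⟨
      a ^ suc (2 * r) * a ^ (k * r + k * r) % m
        ≡⟨ cong (_% m) (^-distribˡ-+-* a (suc (2 * r)) _) ⟨
      a ^ (suc (2 * r) + (k * r + k * r)) % m
        ≡⟨ cong (λ u → a ^ u % m) (exponent k r) ⟨
      a * a ^ (suc k * (2 * r)) % m
        ≡⟨ cong (λ u → a * u % m) (^-*-assoc a (suc k) (2 * r)) ⟨
      a * (a ^ suc k) ^ (2 * r) % m
        ≡⟨ ≋-* {a} refl (≋-^ (2 * r) a^k≋1) ⟩
      a * 1 ^ (2 * r) % m
        ≡⟨ cong (λ u → a * u % m) (^-zeroˡ (2 * r)) ⟩
      a * 1 % m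
        ≡⟨ cong (_% m) (*-identityʳ a) ⟩
      a % m
        ∎

module ModuloPrime (p : ℕ) .{{_ : NonZero p}} (p-prime : Prime p) where
  open Modulo p

  ∤1 : ¬ p ∣ 1
  ∤1 p∣1 = ¬prime[1] (subst Prime (∣1⇒≡1 p∣1) p-prime)

  ∣^⇒∣ : ∀ {z} n → p ∣ z ^ n → p ∣ z
  ∣^⇒∣ zero p∣1 = contradiction p∣1 ∤1
  ∣^⇒∣ {z} (suc n) p∣z*z^n with euclidsLemma z (z ^ n) p-prime p∣z*z^n
  ... | inj₁ p∣z   = p∣z
  ... | inj₂ p∣z^n = ∣^⇒∣ n p∣z^n

  private
    *-cancelˡ-≋-≤ : ∀ {c x y} → ¬ p ∣ c → y ≤ x → c * x ≋ c * y → x ≋ y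
    *-cancelˡ-≋-≤ {c} {x} {y} p∤c y≤x cx≋cy
      with euclidsLemma c (x ∸ y) p-prime (subst (p ∣_) (sym (*-distribˡ-∸ c x y)) (≋⇒∣∸ _ _ cx≋cy))
    ... | inj₁ p∣c   = contradiction p∣c p∤c
    ... | inj₂ p∣x∸y = ∣∸⇒≋ y≤x p∣x∸y

    difference-of-squares : ∀ x y → x * x ∸ y * y ≡ (x ∸ y) * (x + y)
    difference-of-squares x y = begin
      x * x ∸ y * y                     ≡⟨ [m+n]∸[m+o]≡n∸o (x * y) _ _ ⟨
      (x * y + x * x) ∸ (x * y + y * y) ≡⟨ cong₂ (λ u v → u ∸ (v + y * y)) (+-comm (x * y) (x * x)) (*-comm x y) ⟩
      (x * x + x * y) ∸ (y * x + y * y) ≡⟨ cong₂ _∸_ (*-distribˡ-+ x x y) (*-distribˡ-+ y x y) ⟨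
      x * (x + y) ∸ y * (x + y)         ≡⟨ *-distribʳ-∸ (x + y) x y ⟨
      (x ∸ y) * (x + y)                 ∎
      where open ≡-Reasoning

    square≋square-≤ : ∀ {x y} → y ≤ x → x * x ≋ y * y → x ≋ y ⊎ x + y ≋ 0
    square≋square-≤ {x} {y} y≤x x²≋y²
      with euclidsLemma (x ∸ y) (x + y) p-prime
             (subst (p ∣_) (difference-of-squares x y) (≋⇒∣∸ _ _ x²≋y²))
    ... | inj₁ p∣x∸y = inj₁ (∣∸⇒≋ y≤x p∣x∸y)
    ... | inj₂ p∣x+y = inj₂ (∣⇒≋0 p∣x+y)

  *-cancelˡ-≋ : ∀ {c x y} → ¬ p ∣ c → c * x ≋ c * y → x ≋ y
  *-cancelˡ-≋ {x = x} {y} p∤c cx≋cy with ≤-total y x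
  ... | inj₁ y≤x = *-cancelˡ-≋-≤ p∤c y≤x cx≋cy
  ... | inj₂ x≤y = sym (*-cancelˡ-≋-≤ p∤c x≤y (sym cx≋cy))

  square≋square⇒≋⊎+≋0 : ∀ {x y} → x * x ≋ y * y → x ≋ y ⊎ x + y ≋ 0
  square≋square⇒≋⊎+≋0 {x} {y} x²≋y² with ≤-total y x
  ... | inj₁ y≤x = square≋square-≤ y≤x x²≋y²
  ... | inj₂ x≤y with square≋square-≤ x≤y (sym x²≋y²)
  ...   | inj₁ y≋x   = inj₁ (sym y≋x)
  ...   | inj₂ y+x≋0 = inj₂ (trans (cong (_% p) (+-comm x y)) y+x≋0)

  -- Pigeonhole on the residues of z⁰, …, zᵖ, then cancel the smaller power.
  ∃-power≋1 : ∀ {z} → ¬ p ∣ z → ∃ λ k → 1 ≤ k × k ≤ p × z ^ k ≋ 1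
  ∃-power≋1 {z} p∤z with pigeonhole (n<1+n p) (λ (i : Fin (suc p)) → fromℕ< (m%n<n (z ^ toℕ i) p))
  ... | i , j , i<j , residues≡ =
    toℕ j ∸ toℕ i , m<n⇒0<n∸m i<j , ≤-trans (m∸n≤m (toℕ j) (toℕ i)) (s≤s⁻¹ (toℕ<n j)) ,
    sym (*-cancelˡ-≋ (p∤z ∘ ∣^⇒∣ (toℕ i)) z^i*1≋z^i*z^[j-i])
    where
    open ≡-Reasoning
    z^i*1≋z^i*z^[j-i] : z ^ toℕ i * 1 ≋ z ^ toℕ i * z ^ (toℕ j ∸ toℕ i)
    z^i*1≋z^i*z^[j-i] = begin
      z ^ toℕ i * 1 % p                      ≡⟨ cong (_% p) (*-identityʳ _) ⟩
      z ^ toℕ i % p                          ≡⟨ toℕ-fromℕ< (m%n<n (z ^ toℕ i) p) ⟨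
      toℕ (fromℕ< (m%n<n (z ^ toℕ i) p))    ≡⟨ cong toℕ residues≡ ⟩
      toℕ (fromℕ< (m%n<n (z ^ toℕ j) p))    ≡⟨ toℕ-fromℕ< (m%n<n (z ^ toℕ j) p) ⟩
      z ^ toℕ j % p                          ≡⟨ cong (λ u → z ^ u % p) (m+[n∸m]≡n (<⇒≤ i<j)) ⟨
      z ^ (toℕ i + (toℕ j ∸ toℕ i)) % p      ≡⟨ cong (_% p) (^-distribˡ-+-* z (toℕ i) _) ⟩
      z ^ toℕ i * z ^ (toℕ j ∸ toℕ i) % p    ∎

  order-exists : ∀ z → ¬ p ∣ z → ∃ λ k → k ≤ p × IsOrd p z k
  order-exists z p∤z with ∃-power≋1 p∤z
  ... | m , 1≤m , m≤p , z^m≋1 with least-positive (λ j → p ∣? z ^ j ∸ 1) 1≤m (≋⇒∣∸ _ 1 z^m≋1)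
  ...   | k , k≤m , ord = k , ≤-trans k≤m m≤p , ord

  module RootOfMinusOne (g N : ℕ) .{{_ : NonZero g}} (g^2^N+1≋0 : g ^ 2 ^ N + 1 ≋ 0) where

    p∤g : ¬ p ∣ g
    p∤g p∣g = ∤1 (∣m+n∣m⇒∣n (≋0⇒∣ g^2^N+1≋0) (∣⇒∣^ (2 ^ N) {{m^n≢0 2 N}} p∣g))

    g^2^[1+N]≋1 : g ^ 2 ^ suc N ≋ 1
    g^2^[1+N]≋1 = trans (cong (_% p) g^2^[1+N]≡) (+1≋0⇒square≋1 g^2^N+1≋0)
      where
      g^2^[1+N]≡ : g ^ 2 ^ suc N ≡ g ^ 2 ^ N * g ^ 2 ^ N
      g^2^[1+N]≡ = trans (^-distribˡ-+-* g (2 ^ N) _) (cong (λ u → g ^ 2 ^ N * g ^ u) (+-identityʳ (2 ^ N)))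

    order≡2^[1+N] : ¬ p ∣ 2 → ∀ {d} → IsOrd p g d → d ≡ 2 ^ suc N
    order≡2^[1+N] p∤2 ord with ∣p^k⇒≡p^i (suc N) prime[2] (order-∣ ord g^2^[1+N]≋1)
    ... | i , i≤1+N , refl with m≤n⇒m<n∨m≡n i≤1+N
    ...   | inj₂ i≡1+N = cong (2 ^_) i≡1+N
    ...   | inj₁ i<1+N = contradiction (≋0⇒∣ 2≋0) p∤2
      where
      i≤N : i ≤ N
      i≤N = s≤s⁻¹ i<1+N
      g^2^N≋1 : g ^ 2 ^ N ≋ 1
      g^2^N≋1 = trans (cong (λ u → g ^ u % p) 2^N≡) (order-^ ord (2 ^ (N ∸ i)))
        where
        2^N≡ : 2 ^ N ≡ 2 ^ i * 2 ^ (N ∸ i)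
        2^N≡ = trans (cong (2 ^_) (sym (m+[n∸m]≡n i≤N))) (^-distribˡ-+-* 2 i (N ∸ i))
      2≋0 : 2 ≋ 0
      2≋0 = trans (≋-+ {1} (sym g^2^N≋1) refl) g^2^N+1≋0

    -- A square root of g^(J·2^(c+1)) is ±g^(J·2^c), and -1 ≡ g^(2^N).
    square-root-of-power : ∀ {y} J {c e} → N ≡ c + e → y * y ≋ g ^ (J * 2 ^ suc c) →
                           ∃ λ J′ → y ≋ g ^ (J′ * 2 ^ c)
    square-root-of-power {y} J {c} {e} N≡c+e y²≋ with square≋square⇒≋⊎+≋0 (trans y²≋ (cong (_% p) h²≡))
      where
      double : ∀ J t → J * (2 * t) ≡ J * t + J * t
      double = solve-∀
      h²≡ : g ^ (J * 2 ^ suc c) ≡ g ^ (J * 2 ^ c) * g ^ (J * 2 ^ c)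
      h²≡ = trans (cong (g ^_) (double J (2 ^ c))) (^-distribˡ-+-* g (J * 2 ^ c) (J * 2 ^ c))
    ... | inj₁ y≋h   = J , y≋h
    ... | inj₂ y+h≋0 = J + 2 ^ e , trans (≋-negate g^2^N+1≋0 y+h≋0) (cong (_% p) h*g^2^N≡)
      where
      shift : ∀ J a b → J * b + b * a ≡ (J + a) * b
      shift = solve-∀
      h*g^2^N≡ : g ^ (J * 2 ^ c) * g ^ 2 ^ N ≡ g ^ ((J + 2 ^ e) * 2 ^ c)
      h*g^2^N≡ = begin
        g ^ (J * 2 ^ c) * g ^ 2 ^ N          ≡⟨ ^-distribˡ-+-* g (J * 2 ^ c) (2 ^ N) ⟨
        g ^ (J * 2 ^ c + 2 ^ N)              ≡⟨ cong (λ u → g ^ (J * 2 ^ c + 2 ^ u)) N≡c+e ⟩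
        g ^ (J * 2 ^ c + 2 ^ (c + e))        ≡⟨ cong (λ u → g ^ (J * 2 ^ c + u)) (^-distribˡ-+-* 2 c e) ⟩
        g ^ (J * 2 ^ c + 2 ^ c * 2 ^ e)      ≡⟨ cong (g ^_) (shift J (2 ^ e) (2 ^ c)) ⟩
        g ^ ((J + 2 ^ e) * 2 ^ c)            ∎
        where open ≡-Reasoning

    root-of-unity≋power : ∀ e c → c + e ≡ suc N → ∀ {y} → y ^ 2 ^ e ≋ 1 →
                          ∃ λ J → y ≋ g ^ (J * 2 ^ c)
    root-of-unity≋power zero c _ {y} y^1≋1 = 0 , trans (cong (_% p) (sym (*-identityʳ y))) y^1≋1
    root-of-unity≋power (suc e) c c+1+e≡1+N {y} y^2^[1+e]≋1
      with J , y²≋ ← root-of-unity≋power e (suc c) (trans (sym (+-suc c e)) c+1+e≡1+N)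
                       (trans (cong (_% p) ([m*m]^n≡m^[2*n] y (2 ^ e))) y^2^[1+e]≋1)
      = square-root-of-power J {c} {e} (suc-injective (trans (sym c+1+e≡1+N) (+-suc c e))) y²≋

    root-of-unity⇒QR : QR g p → ∀ {y e} → e ≤ suc N → y ^ 2 ^ e ≋ 1 → QR y p
    root-of-unity⇒QR qr-g {e = e} e≤1+N y^2^e≋1
      with J , y≋ ← root-of-unity≋power e (suc N ∸ e) (m∸n+n≡m e≤1+N) y^2^e≋1
      = QR-resp-≋ (sym y≋) (QR-^ qr-g (J * 2 ^ (suc N ∸ e)))

    order≤⇒QR : QR g p → ∀ {a k} .{{_ : NonZero a}} → IsOrd p a k → k ≤ 2 ^ suc N → QR a p
    order≤⇒QR qr-g {a} {k} ord@(1≤k , _) k≤2^[1+N] with ≡2^e*odd k 1≤k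
    ... | e , r , refl = QR-of-odd-power r (IsOrd⇒^≋1 ord) 1≤k (root-of-unity⇒QR qr-g e≤1+N a^M^2^e≋1)
      where
      M : ℕ
      M = suc (2 * r)
      e≤1+N : e ≤ suc N
      e≤1+N = ≮⇒≥ λ 1+N<e → <⇒≱ (^-monoʳ-< 2 (s<s z<s) 1+N<e) (≤-trans (m≤m*n (2 ^ e) M) k≤2^[1+N])
      a^M^2^e≋1 : (a ^ M) ^ 2 ^ e ≋ 1
      a^M^2^e≋1 = trans (cong (_% p) (trans (^-*-assoc a M (2 ^ e)) (cong (a ^_) (*-comm M (2 ^ e)))))
                        (IsOrd⇒^≋1 ord)

F[2+n]≡[2^2^n]^4+1 : ∀ n → F (2 + n) ≡ (2 ^ 2 ^ n) ^ 4 + 1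
F[2+n]≡[2^2^n]^4+1 n = cong (_+ 1) (begin
  2 ^ (2 * (2 * 2 ^ n))  ≡⟨ cong (2 ^_) (*-assoc 2 2 (2 ^ n)) ⟨
  2 ^ (4 * 2 ^ n)        ≡⟨ cong (2 ^_) (*-comm 4 (2 ^ n)) ⟩
  2 ^ (2 ^ n * 4)        ≡⟨ ^-*-assoc 2 (2 ^ n) 4 ⟨
  (2 ^ 2 ^ n) ^ 4        ∎)
  where open ≡-Reasoning

order-dominant-at-Fermat-divisor : ∀ n {p A} .{{_ : NonZero p}} .{{_ : NonZero A}} →
  Prime p → p ∣ F (2 + n) → ¬ p ∣ A → ¬ QR A p →
  ¬ p ∣ 2 × 2 ^ (3 + n) ≤ p × ∃₂ λ k l → IsOrd p A k × IsOrd p 2 l × l < k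
order-dominant-at-Fermat-divisor n {p} {A} p-prime p∣F p∤A A∉QR =
  let l , l≤p , ord-2 = order-exists 2 p∤2
      k , _ , ord-A   = order-exists A p∤A
      l≡2^[3+n] : l ≡ 2 ^ (3 + n)
      l≡2^[3+n] = order≡2^[1+N] p∤2 ord-2
      k≰l : ¬ k ≤ l
      k≰l k≤l = A∉QR (order≤⇒QR QR[2] ord-A (≤-trans k≤l (≤-reflexive l≡2^[3+n])))
  in p∤2 , subst (_≤ p) l≡2^[3+n] l≤p , k , l , ord-A , ord-2 , ≰⇒> k≰l
  where
  open Modulo p
  open ModuloPrime p p-prime
  F≋0 : 2 ^ 2 ^ (2 + n) + 1 ≋ 0
  F≋0 = ∣⇒≋0 p∣F
  open RootOfMinusOne 2 (2 + n) F≋0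
  p∤2 : ¬ p ∣ 2
  p∤2 = p∤g
  QR[2] : QR 2 p
  QR[2] = w⁴+1≋0⇒QR[2] (2 ^ 2 ^ n) (subst (λ u → u ≋ 0) (F[2+n]≡[2^2^n]^4+1 n) F≋0)

lemma3p1 : (A : ℕ) → 1 ≤ A →
    (∀ N → ∃ λ n → N < n × Jacobi A (F n) (-[1+ 0 ])) →
    ∀ N → ∃ λ p → N < p × Prime p × ¬ (p ∣ A) × ¬ (p ∣ 2) ×
      ∃ λ k → ∃ λ l → IsOrd p A k × IsOrd p 2 l × l < k
lemma3p1 A 1≤A jacobi≡-1 N with jacobi≡-1 (suc N)
... | suc (suc n) , s<s N<1+n , J with jacobi≡-1⇒legendre≡-1 J refl
... | p , p-prime , p∣F , leg-minus p∤A A∉QR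
  with p∤2 , 2^[3+n]≤p , dominant ←
         order-dominant-at-Fermat-divisor n {{prime⇒nonZero p-prime}} {{>-nonZero 1≤A}} p-prime p∣F p∤A A∉QR
  = p , N<p , p-prime , p∤A , p∤2 , dominant
  where
  N<p : N < p
  N<p = begin-strict
    N           ≤⟨ s≤s⁻¹ N<1+n ⟩
    n           ≤⟨ m≤n+m n 3 ⟩
    3 + n       <⟨ n<2^n (3 + n) ⟩
    2 ^ (3 + n) ≤⟨ 2^[3+n]≤p ⟩
    p           ∎
    where open ≤-Reasoning
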